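{- For closed $\lambda$-terms $M$ and $N$, if $M$ $\beta\mathbf{\Omega}$-converts to $N$, then $M =_{\omega} N$.
   Context: $[N/x]U$ is capture-avoiding substitution; $\mathbf{\Omega}\equiv(\lambda x.xx)(\lambda x.xx)$; a term is unsolvable if its closure applied to no sequence of closed terms $\beta$-converts to $\lambda x.x$. $\beta\mathbf{\Omega}$-conversion is the convertibility relation generated by the notion of reduction consisting of $\beta$-reduction together with the rule $U\to\mathbf{\Omega}$ for $U$ unsolvable with $U\not\equiv\mathbf{\Omega}$, closed under contexts. The relation $=_{\omega}$ on closed terms is the least relation such that: $M=_\omega M$; $(\lambda x.U)N =_{\omega} [N/x]U$ and $[N/x]U =_\omega (\lambda x.U)N$ for closed $(\lambda x.U)N$; $M=_\omega\mathbf{\Omega}$ and $\mathbf{\Omega}=_\omega M$ for closed unsolvable $M$; if $X,Y$ have no free variable other than possibly $z$, $[M/z]X=_\omega[M/z]Y$ and $M=_\omega N$, then $[N/z]X=_\omega[N/z]Y$ (Leibniz rule); and if $PM=_\omega QM$ for all closed $M$ then $P=_\omega Q$ ($\omega$-rule). -}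

module Defs where

open import Data.Nat using (ℕ; zero; suc)
open import Data.Fin using (Fin; zero; suc)
open import Data.List using (List; []; _∷_)
open import Data.Empty using (⊥)
open import Relation.Nullary using (¬_)
open import Relation.Binary.PropositionalEquality using (_≡_)
open import Relation.Binary.Construct.Closure.Equivalence using (EqClosure)

-- Well-scoped de Bruijn λ-terms: Tm n = terms with free variables among n.
-- Syntactic identity (≡) is α-equivalence.
data Tm (n : ℕ) : Set where
  var : Fin n → Tm n
  app : Tm n → Tm n → Tm n
  lam : Tm (suc n) → Tm n

Closed : Set
Closed = Tm 0

Ren : ℕ → ℕ → Set
Ren m n = Fin m → Fin n

liftR : ∀ {m n} → Ren m n → Ren (suc m) (suc n)
liftR ρ zero    = zero
liftR ρ (suc i) = suc (ρ i)

ren : ∀ {m n} → Ren m n → Tm m → Tm n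
ren ρ (var i)   = var (ρ i)
ren ρ (app t u) = app (ren ρ t) (ren ρ u)
ren ρ (lam t)   = lam (ren (liftR ρ) t)

Sub : ℕ → ℕ → Set
Sub m n = Fin m → Tm n

liftS : ∀ {m n} → Sub m n → Sub (suc m) (suc n)
liftS σ zero    = var zero
liftS σ (suc i) = ren suc (σ i)

sub : ∀ {m n} → Sub m n → Tm m → Tm n
sub σ (var i)   = σ i
sub σ (app t u) = app (sub σ t) (sub σ u)
sub σ (lam t)   = lam (sub (liftS σ) t)

sub0 : ∀ {n} → Tm n → Sub (suc n) n
sub0 N zero    = N
sub0 N (suc i) = var i

_[_/0] : ∀ {n} → Tm (suc n) → Tm n → Tm n
U [ N /0] = sub (sub0 N) U

weaken : ∀ {n} → Closed → Tm n
weaken {n} = ren (λ ())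

I : Closed
I = lam (var zero)

ω : Closed
ω = lam (app (var zero) (var zero))

Ω : Closed
Ω = app ω ω

data _→β_ {n : ℕ} : Tm n → Tm n → Set where
  β    : ∀ (U : Tm (suc n)) (N : Tm n) → app (lam U) N →β (U [ N /0])
  appL : ∀ {M M′ N} → M →β M′ → app M N →β app M′ N
  appR : ∀ {M N N′} → N →β N′ → app M N →β app M N′
  lamC : ∀ {M M′ : Tm (suc n)} → M →β M′ → lam M →β lam M′

_=β_ : ∀ {n} → Tm n → Tm n → Set
_=β_ = EqClosure _→β_

close : ∀ {n} → Tm n → Closed
close {zero}  t = t
close {suc n} t = close (lam t)

apps : Closed → List Closed → Closed
apps M []       = M
apps M (N ∷ Ns) = apps (app M N) Ns

Unsolvable : ∀ {n} → Tm n → Set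
Unsolvable U = ∀ (Ns : List Closed) → ¬ (apps (close U) Ns =β I)

data _→βΩ_ {n : ℕ} : Tm n → Tm n → Set where
  β     : ∀ (U : Tm (suc n)) (N : Tm n) → app (lam U) N →βΩ (U [ N /0])
  Ωrule : ∀ (U : Tm n) → Unsolvable U → ¬ (U ≡ weaken Ω) → U →βΩ weaken Ω
  appL  : ∀ {M M′ N} → M →βΩ M′ → app M N →βΩ app M′ N
  appR  : ∀ {M N N′} → N →βΩ N′ → app M N →βΩ app M N′
  lamC  : ∀ {M M′ : Tm (suc n)} → M →βΩ M′ → lam M →βΩ lam M′

_=βΩ_ : ∀ {n} → Tm n → Tm n → Set
_=βΩ_ = EqClosure _→βΩ_

data _=ω_ : Closed → Closed → Set where
  reflω    : ∀ M → M =ω M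
  βω       : ∀ (U : Tm 1) (N : Closed) → app (lam U) N =ω (U [ N /0])
  βω⁻      : ∀ (U : Tm 1) (N : Closed) → (U [ N /0]) =ω app (lam U) N
  Ωω       : ∀ M → Unsolvable M → M =ω Ω
  Ωω⁻      : ∀ M → Unsolvable M → Ω =ω M
  leibniz  : ∀ (X Y : Tm 1) (M N : Closed) →
             (X [ M /0]) =ω (Y [ M /0]) → M =ω N → (X [ N /0]) =ω (Y [ N /0])
  ωrule    : ∀ (P Q : Closed) → (∀ (M : Closed) → app P M =ω app Q M) → P =ω Q

-- A βΩ-step between open terms becomes an =ω-step after any closing
-- substitution σ: a β-step is an instance of the β-rule of =ω, an Ω-step is the
-- Ω-rule because unsolvability survives closing substitutions (the closure of U
-- applied to the values of σ β-reduces to σU), a step inside an application is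
-- the Leibniz rule, and a step under λ is the ω-rule, which is why open terms
-- and closing substitutions are needed at all.  The Leibniz rule also makes =ω
-- an equivalence, so it contains the equivalence closure of →βΩ.
module Submission where

open import Defs
open import Data.Nat using (zero; suc)
open import Data.Fin using (zero; suc)
open import Data.List using (List; []; _∷_; _++_)
open import Data.List.Properties using (++-assoc)
open import Data.Product using (∃; _,_)
open import Function using (_∘_)
open import Data.Vec.Functional using (tail) renaming (_∷_ to _∷ᵛ_)
open import Relation.Binary.PropositionalEquality
open import Relation.Binary.Structures using (IsEquivalence)
open import Relation.Binary.Construct.Closure.Equivalence as EqClosure using ()

ren-cong : ∀ {m n} {ρ ρ′ : Ren m n} → (∀ i → ρ i ≡ ρ′ i) → ∀ t → ren ρ t ≡ ren ρ′ t
ren-cong ρ≗ρ′ (var i)   = cong var (ρ≗ρ′ i)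
ren-cong ρ≗ρ′ (app t u) = cong₂ app (ren-cong ρ≗ρ′ t) (ren-cong ρ≗ρ′ u)
ren-cong ρ≗ρ′ (lam t)   = cong lam (ren-cong lift≗ t)
  where
  lift≗ : ∀ i → liftR _ i ≡ liftR _ i
  lift≗ zero    = refl
  lift≗ (suc i) = cong suc (ρ≗ρ′ i)

sub-cong : ∀ {m n} {σ τ : Sub m n} → (∀ i → σ i ≡ τ i) → ∀ t → sub σ t ≡ sub τ t
sub-cong σ≗τ (var i)   = σ≗τ i
sub-cong σ≗τ (app t u) = cong₂ app (sub-cong σ≗τ t) (sub-cong σ≗τ u)
sub-cong σ≗τ (lam t)   = cong lam (sub-cong lift≗ t)
  where
  lift≗ : ∀ i → liftS _ i ≡ liftS _ i
  lift≗ zero    = refl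
  lift≗ (suc i) = cong (ren suc) (σ≗τ i)

ren-ren : ∀ {l m n} (ρ : Ren m n) (ρ′ : Ren l m) t →
          ren ρ (ren ρ′ t) ≡ ren (λ i → ρ (ρ′ i)) t
ren-ren ρ ρ′ (var i)   = refl
ren-ren ρ ρ′ (app t u) = cong₂ app (ren-ren ρ ρ′ t) (ren-ren ρ ρ′ u)
ren-ren ρ ρ′ (lam t)   =
  cong lam (trans (ren-ren (liftR ρ) (liftR ρ′) t) (ren-cong lift-∘ t))
  where
  lift-∘ : ∀ i → liftR ρ (liftR ρ′ i) ≡ liftR (λ i → ρ (ρ′ i)) i
  lift-∘ zero    = refl
  lift-∘ (suc i) = refl

sub-ren : ∀ {l m n} (σ : Sub m n) (ρ : Ren l m) t →
          sub σ (ren ρ t) ≡ sub (λ i → σ (ρ i)) t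
sub-ren σ ρ (var i)   = refl
sub-ren σ ρ (app t u) = cong₂ app (sub-ren σ ρ t) (sub-ren σ ρ u)
sub-ren σ ρ (lam t)   =
  cong lam (trans (sub-ren (liftS σ) (liftR ρ) t) (sub-cong lift-∘ t))
  where
  lift-∘ : ∀ i → liftS σ (liftR ρ i) ≡ liftS (λ i → σ (ρ i)) i
  lift-∘ zero    = refl
  lift-∘ (suc i) = refl

ren-sub : ∀ {l m n} (ρ : Ren m n) (σ : Sub l m) t →
          ren ρ (sub σ t) ≡ sub (λ i → ren ρ (σ i)) t
ren-sub ρ σ (var i)   = refl
ren-sub ρ σ (app t u) = cong₂ app (ren-sub ρ σ t) (ren-sub ρ σ u)
ren-sub ρ σ (lam t)   =
  cong lam (trans (ren-sub (liftR ρ) (liftS σ) t) (sub-cong lift-∘ t))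
  where
  lift-∘ : ∀ i → ren (liftR ρ) (liftS σ i) ≡ liftS (λ i → ren ρ (σ i)) i
  lift-∘ zero    = refl
  lift-∘ (suc i) = trans (ren-ren (liftR ρ) suc (σ i)) (sym (ren-ren suc ρ (σ i)))

sub-sub : ∀ {l m n} (τ : Sub m n) (σ : Sub l m) t →
          sub τ (sub σ t) ≡ sub (λ i → sub τ (σ i)) t
sub-sub τ σ (var i)   = refl
sub-sub τ σ (app t u) = cong₂ app (sub-sub τ σ t) (sub-sub τ σ u)
sub-sub τ σ (lam t)   =
  cong lam (trans (sub-sub (liftS τ) (liftS σ) t) (sub-cong lift-∘ t))
  where
  lift-∘ : ∀ i → sub (liftS τ) (liftS σ i) ≡ liftS (λ i → sub τ (σ i)) i
  lift-∘ zero    = refl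
  lift-∘ (suc i) = trans (sub-ren (liftS τ) suc (σ i)) (sym (ren-sub suc τ (σ i)))

sub-var : ∀ {n} (t : Tm n) → sub var t ≡ t
sub-var (var i)   = refl
sub-var (app t u) = cong₂ app (sub-var t) (sub-var u)
sub-var (lam t)   = cong lam (trans (sub-cong liftS-var t) (sub-var t))
  where
  liftS-var : ∀ i → liftS var i ≡ var i
  liftS-var zero    = refl
  liftS-var (suc i) = refl

sub-closed : (σ : Sub 0 0) (t : Closed) → sub σ t ≡ t
sub-closed σ t = trans (sub-cong (λ ()) t) (sub-var t)

sub-weaken : ∀ {n} (σ : Sub n 0) (t : Closed) → sub σ (weaken t) ≡ t
sub-weaken σ t = trans (sub-ren σ (λ ()) t) (sub-closed _ t)

sub-liftS-[/0] : ∀ {m n} (σ : Sub m n) (K : Tm n) (t : Tm (suc m)) →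
                 sub (liftS σ) t [ K /0] ≡ sub (K ∷ᵛ σ) t
sub-liftS-[/0] σ K t = trans (sub-sub (sub0 K) (liftS σ) t) (sub-cong lift-∘ t)
  where
  lift-∘ : ∀ i → sub (sub0 K) (liftS σ i) ≡ (K ∷ᵛ σ) i
  lift-∘ zero    = refl
  lift-∘ (suc i) = trans (sub-ren (sub0 K) suc (σ i)) (sub-var (σ i))

sub-[/0] : ∀ {m n} (σ : Sub m n) (U : Tm (suc m)) (N : Tm m) →
           sub σ (U [ N /0]) ≡ sub (liftS σ) U [ sub σ N /0]
sub-[/0] σ U N = begin
  sub σ (U [ N /0])                   ≡⟨ sub-sub σ (sub0 N) U ⟩
  sub (λ i → sub σ (sub0 N i)) U      ≡⟨ sub-cong cons≗ U ⟩
  sub (sub σ N ∷ᵛ σ) U                ≡⟨ sym (sub-liftS-[/0] σ (sub σ N) U) ⟩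
  sub (liftS σ) U [ sub σ N /0]       ∎
  where
  open ≡-Reasoning
  cons≗ : ∀ i → sub σ (sub0 N i) ≡ (sub σ N ∷ᵛ σ) i
  cons≗ zero    = refl
  cons≗ (suc i) = refl

weaken-[/0] : (M N : Closed) → weaken M [ N /0] ≡ M
weaken-[/0] M N = sub-weaken (sub0 N) M

symω : ∀ {M N} → M =ω N → N =ω M
symω {M} {N} M=N = subst (N =ω_) (weaken-[/0] M N)
  (leibniz (var zero) (weaken M) M N
    (subst (M =ω_) (sym (weaken-[/0] M M)) (reflω M)) M=N)

transω : ∀ {M N P} → M =ω N → N =ω P → M =ω P
transω {M} {N} {P} M=N N=P = subst (_=ω P) (weaken-[/0] M P)
  (leibniz (weaken M) (var zero) N P
    (subst (_=ω N) (sym (weaken-[/0] M N)) M=N) N=P)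

=ω-isEquivalence : IsEquivalence _=ω_
=ω-isEquivalence = record { refl = reflω _ ; sym = symω ; trans = transω }

congω : ∀ (X : Tm 1) {M N} → M =ω N → (X [ M /0]) =ω (X [ N /0])
congω X {M} {N} M=N = subst (_=ω (X [ N /0])) (weaken-[/0] (X [ M /0]) N)
  (leibniz (weaken (X [ M /0])) X M N
    (subst (_=ω (X [ M /0])) (sym (weaken-[/0] (X [ M /0]) M)) (reflω _)) M=N)

appˡ-congω : ∀ {A B} C → A =ω B → app A C =ω app B C
appˡ-congω {A} {B} C =
  subst₂ _=ω_ (cong (app A) (weaken-[/0] C A)) (cong (app B) (weaken-[/0] C B))
    ∘ congω (app (var zero) (weaken C))

appʳ-congω : ∀ {A B} C → A =ω B → app C A =ω app C B
appʳ-congω {A} {B} C =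
  subst₂ _=ω_ (cong (λ f → app f A) (weaken-[/0] C A)) (cong (λ f → app f B) (weaken-[/0] C B))
    ∘ congω (app (weaken C) (var zero))

apps-→β : ∀ {M M′} Ns → M →β M′ → apps M Ns →β apps M′ Ns
apps-→β []       M→M′ = M→M′
apps-→β (N ∷ Ns) M→M′ = apps-→β Ns (appL M→M′)

apps-close-=β-sub : ∀ {n} (t : Tm n) (σ : Sub n 0) →
                    ∃ λ As → ∀ Ns → apps (close t) (As ++ Ns) =β apps (sub σ t) Ns
apps-close-=β-sub {zero} t σ =
  [] , λ Ns → subst (λ u → apps t Ns =β apps u Ns) (sym (sub-closed σ t)) (EqClosure.reflexive _→β_)
apps-close-=β-sub {suc n} t σ with apps-close-=β-sub (lam t) (tail σ)
... | As , close-lam-t = As ++ σ zero ∷ [] , λ Ns →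
  subst (λ L → apps (close t) L =β apps (sub σ t) Ns) (sym (++-assoc As (σ zero ∷ []) Ns))
    (EqClosure.transitive _→β_ (close-lam-t (σ zero ∷ Ns)) (EqClosure.return (β-step Ns)))
  where
  head∷tail : ∀ i → (σ zero ∷ᵛ tail σ) i ≡ σ i
  head∷tail zero    = refl
  head∷tail (suc i) = refl

  β-result : sub (liftS (tail σ)) t [ σ zero /0] ≡ sub σ t
  β-result = trans (sub-liftS-[/0] (tail σ) (σ zero) t) (sub-cong head∷tail t)

  β-step : ∀ Ns → apps (sub (tail σ) (lam t)) (σ zero ∷ Ns) →β apps (sub σ t) Ns
  β-step Ns = subst (λ u → apps (sub (tail σ) (lam t)) (σ zero ∷ Ns) →β apps u Ns) β-result
    (apps-→β Ns (β (sub (liftS (tail σ)) t) (σ zero)))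

Unsolvable-sub : ∀ {n} (U : Tm n) (σ : Sub n 0) → Unsolvable U → Unsolvable (sub σ U)
Unsolvable-sub U σ U-unsolvable Ns σU=I with apps-close-=β-sub U σ
... | As , close-U = U-unsolvable (As ++ Ns) (EqClosure.transitive _→β_ (close-U Ns) σU=I)

→βΩ-sub-=ω : ∀ {n} {M N : Tm n} → M →βΩ N → (σ : Sub n 0) → sub σ M =ω sub σ N
→βΩ-sub-=ω (β U N) σ =
  subst (sub σ (app (lam U) N) =ω_) (sym (sub-[/0] σ U N)) (βω (sub (liftS σ) U) (sub σ N))
→βΩ-sub-=ω (Ωrule U U-unsolvable _) σ =
  subst (sub σ U =ω_) (sym (sub-weaken σ Ω)) (Ωω _ (Unsolvable-sub U σ U-unsolvable))
→βΩ-sub-=ω (appL {N = K} M→M′) σ = appˡ-congω (sub σ K) (→βΩ-sub-=ω M→M′ σ)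
→βΩ-sub-=ω (appR {M = K} N→N′) σ = appʳ-congω (sub σ K) (→βΩ-sub-=ω N→N′ σ)
→βΩ-sub-=ω (lamC {M = M} {M′} M→M′) σ = ωrule _ _ λ K →
  transω (βω _ K)
    (transω (subst₂ _=ω_ (sym (sub-liftS-[/0] σ K M)) (sym (sub-liftS-[/0] σ K M′))
                         (→βΩ-sub-=ω M→M′ (K ∷ᵛ σ)))
      (βω⁻ _ K))

proposition3p3 : (M N : Closed) → M =βΩ N → M =ω N
proposition3p3 M N = EqClosure.fold =ω-isEquivalence λ {M} {N} M→N →
  subst₂ _=ω_ (sub-closed (λ ()) M) (sub-closed (λ ()) N) (→βΩ-sub-=ω M→N (λ ()))
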